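{- Let $K$ be the clique complex of a graph on vertex set $[n]$, let $k\ge0$ be an integer, and let $\Delta_k$ be the $k$-th combinatorial Laplacian of $K$. Then for every $k$-face $i$, $$|\{j:(\Delta_k)_{ij}\neq0\}|\le n-k-d^{\mathrm{up}}_i,$$ where $d^{\mathrm{up}}_i$ is the up-degree of the $k$-face $i$.
   Context: The clique complex of a graph $G$ with vertex set $[n]$ is the family of vertex subsets inducing cliques in $G$; its $k$-faces are the cliques of size $k+1$. With faces oriented increasingly ($i_1<\dots<i_{k+1}$), identified with orthonormal basis vectors, and boundary operator $\partial_k|\{i_1,\dots,i_{k+1}\}\rangle=\sum_{\ell=1}^{k+1}(-1)^{\ell-1}|\{i_1,\dots,i_{k+1}\}\setminus\{i_\ell\}\rangle$ (with $\emptyset$ the unique $(-1)$-face), the $k$-th combinatorial Laplacian is $\Delta_k=\partial_k^\dagger\partial_k+\partial_{k+1}\partial_{k+1}^\dagger$, a matrix indexed by $k$-faces. The up-degree of a $k$-face is the number of $(k+1)$-faces containing it. -}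

module Defs where

open import Data.Nat using (ℕ; zero; suc)
open import Data.Bool using (Bool; true; false)
import Data.Bool.Properties as BoolP
open import Data.Fin using (Fin; _<_)
open import Data.Fin.Properties using (all?; _<?_) renaming (_≟_ to _≟ᶠ_)
open import Data.Fin.Subset using (Subset; inside; outside; _∈_; _⊆_; _-_; ∣_∣)
open import Data.Fin.Subset.Properties using (_∈?_)
open import Data.Vec using (Vec; []; _∷_)
import Data.Vec.Properties as VecP
open import Data.List using (List; []; _∷_; [_]; map; _++_; filter; foldr; length; allFin)
open import Data.Integer using (ℤ; 0ℤ; 1ℤ; -_; _+_; _*_)
open import Data.Product using (_×_)
open import Relation.Nullary using (Dec; yes; no; ¬_; ¬?; _×-dec_; _→-dec_)
open import Relation.Binary.PropositionalEquality using (_≡_; _≢_)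
import Data.Nat.Properties as NatP

record Graph (n : ℕ) : Set where
  field
    Adj       : Fin n → Fin n → Bool
    Adj-sym   : ∀ u v → Adj u v ≡ Adj v u
    Adj-irrefl : ∀ v → Adj v v ≡ false
open Graph public

_≟ˢ_ : ∀ {n} (p q : Subset n) → Dec (p ≡ q)
_≟ˢ_ = VecP.≡-dec BoolP._≟_

allSubsets : (n : ℕ) → List (Subset n)
allSubsets zero = [ [] ]
allSubsets (suc n) = map (outside ∷_) (allSubsets n) ++ map (inside ∷_) (allSubsets n)

Clique : ∀ {n} → Graph n → Subset n → Set
Clique G s = ∀ u v → u ∈ s → v ∈ s → u ≢ v → Adj G u v ≡ true

clique? : ∀ {n} (G : Graph n) (s : Subset n) → Dec (Clique G s)
clique? G s = all? λ u → all? λ v →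
  (u ∈? s) →-dec ((v ∈? s) →-dec (¬? (u ≟ᶠ v) →-dec (Adj G u v BoolP.≟ true)))

-- The cliques of size m (= the (m-1)-faces of the clique complex; m = 0 gives ∅).
cliquesOfSize : ∀ {n} → Graph n → ℕ → List (Subset n)
cliquesOfSize {n} G m = filter (λ s → clique? G s ×-dec (∣ s ∣ NatP.≟ m)) (allSubsets n)

faces : ∀ {n} → Graph n → ℕ → List (Subset n)
faces G k = cliquesOfSize G (suc k)

IsFace : ∀ {n} → Graph n → ℕ → Subset n → Set
IsFace G k s = Clique G s × ∣ s ∣ ≡ suc k

sumℤ : List ℤ → ℤ
sumℤ = foldr _+_ 0ℤ

sgn : ℕ → ℤ
sgn zero = 1ℤ
sgn (suc m) = - sgn m

-- Number of elements of τ smaller than v; if v ∈ τ, v is the ℓ-th element of τ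
-- (in increasing order) with ℓ - 1 = smaller τ v.
smaller : ∀ {n} → Subset n → Fin n → ℕ
smaller {n} τ v = length (filter (λ u → (u ∈? τ) ×-dec (u <? v)) (allFin n))

-- Coefficient of the basis vector |σ⟩ in ∂|τ⟩ = Σ_ℓ (-1)^(ℓ-1) |τ ∖ {τ_ℓ}⟩.
inc : ∀ {n} → Subset n → Subset n → ℤ
inc {n} σ τ = sumℤ (map term (allFin n))
  where
  term : Fin n → ℤ
  term v with v ∈? τ | σ ≟ˢ (τ - v)
  ... | yes _ | yes _ = sgn (smaller τ v)
  ... | yes _ | no _  = 0ℤ
  ... | no _  | _     = 0ℤ

-- Entry (i, j) of the k-th combinatorial Laplacian
-- Δ_k = ∂_k^† ∂_k + ∂_{k+1} ∂_{k+1}^† of the clique complex of G.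
laplacian : ∀ {n} → Graph n → ℕ → Subset n → Subset n → ℤ
laplacian G k i j =
  sumℤ (map (λ σ → inc σ i * inc σ j) (cliquesOfSize G k))
  + sumℤ (map (λ τ → inc i τ * inc j τ) (cliquesOfSize G (suc (suc k))))

upDegree : ∀ {n} → Graph n → ℕ → Subset n → ℕ
upDegree {n} G k i =
  length (filter (λ τ → all? (λ u → (u ∈? i) →-dec (u ∈? τ))) (cliquesOfSize G (suc (suc k))))

rowSupport : ∀ {n} → Graph n → ℕ → Subset n → ℕ
rowSupport G k i =
  length (filter (λ j → ¬? (laplacian G k i j Data.Integer.≟ 0ℤ)) (faces G k))

-- Let i be a k-face. A k-face j ≠ i can only have (Δ_k)_{ij} ≠ 0 if j = (i ∖ u) ∪ {v} for
-- some u ∈ i and v ∉ i; then both sums of the Laplacian have a single nonzero term, the down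
-- term through i ∖ u and, if i ∪ {v} is a clique, the up term through i ∪ {v}, and these two
-- cancel. So every such j comes with a new vertex v ∉ i for which i ∪ {v} is not a clique,
-- and two such j with the same v coincide, since otherwise they would cover all edges of
-- i ∪ {v}. The (k+1)-faces above i are i ∪ {v} with i ∪ {v} a clique. Hence the off-diagonal
-- support of the row and the up-neighbours of i inject into the n - (k + 1) vertices outside
-- i, and the diagonal entry contributes at most one more.
module Submission where

open import Defs
open import Data.Nat using (ℕ)
open import Data.Integer using (+_; _-_; _≤_)
open import Data.Fin.Subset using (Subset)

open import Data.Nat as ℕ using (suc; _+_; _∸_; z≤n; s≤s)
import Data.Nat.Properties as ℕₚ
open import Data.Integer as ℤ using (ℤ; 0ℤ; _*_; -_)
import Data.Integer.Properties as ℤₚ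
open import Data.Bool using (true)
open import Data.Fin using (Fin; zero; suc; _<_)
import Data.Fin.Properties as Finₚ
open import Data.Fin.Subset
  using (inside; outside; ⁅_⁆; _∪_; ∁; _∈_; _∉_; _⊆_; ∣_∣)
  renaming (_-_ to _∖_)
import Data.Fin.Subset.Properties as Subsetₚ
open import Data.Fin.Subset.Properties using (_∈?_)
open import Data.Vec using ([]; _∷_; here; there)
open import Data.Vec.Properties using (∷-injectiveʳ)
open import Data.List using (List; []; _∷_; map; filter; length; allFin; _++_)
import Data.List.Properties as Listₚ
open import Data.List.Membership.Propositional using () renaming (_∈_ to _∈ₗ_)
import Data.List.Membership.Propositional.Properties as Memₚ
open import Data.List.Relation.Unary.Any using (here; there)
open import Data.List.Relation.Unary.All as All using ([])
open import Data.List.Relation.Unary.AllPairs using ([]; _∷_)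
open import Data.List.Relation.Unary.Unique.Propositional using (Unique)
import Data.List.Relation.Unary.Unique.Propositional.Properties as Uniqueₚ
open import Data.Product using (_×_; _,_; proj₁; proj₂; ∃₂; ∃-syntax)
open import Data.Sum using (_⊎_; inj₁; inj₂; [_,_])
open import Data.Empty using (⊥; ⊥-elim)
open import Function using (_∘_; _⇔_; mk⇔; Equivalence)
open import Relation.Nullary using (yes; no; ¬_; ¬?; contradiction; _×-dec_; _→-dec_)
open import Relation.Nullary.Decidable using (decidable-stable)
open import Level using (0ℓ)
open import Relation.Unary using (Pred; Decidable)
open import Relation.Binary using (DecidableEquality; tri<; tri≈; tri>)
open import Relation.Binary.PropositionalEquality
  using (_≡_; _≢_; refl; sym; trans; cong; cong₂; subst; subst₂; ≢-sym; module ≡-Reasoning)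
open ≡-Reasoning

open Equivalence using (to; from)

private
  variable
    n k : ℕ
    G : Graph n
    p q σ τ i j s t : Subset n
    u v w x y : Fin n

module _ {A : Set} (f : A → ℤ) where

  sumℤ-map-≢0 : ∀ xs → sumℤ (map f xs) ≢ 0ℤ → ∃[ x ] x ∈ₗ xs × f x ≢ 0ℤ
  sumℤ-map-≢0 [] sum≢0 = contradiction refl sum≢0
  sumℤ-map-≢0 (x ∷ xs) sum≢0 with f x ℤ.≟ 0ℤ
  ... | no fx≢0 = x , here refl , fx≢0
  ... | yes fx≡0 with sumℤ-map-≢0 xs (λ rest≡0 → sum≢0 (cong₂ ℤ._+_ fx≡0 rest≡0))
  ...   | y , y∈xs , fy≢0 = y , there y∈xs , fy≢0

  sumℤ-map-≡0 : ∀ xs → (∀ {x} → x ∈ₗ xs → f x ≡ 0ℤ) → sumℤ (map f xs) ≡ 0ℤ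
  sumℤ-map-≡0 [] _ = refl
  sumℤ-map-≡0 (x ∷ xs) f≡0 = cong₂ ℤ._+_ (f≡0 (here refl)) (sumℤ-map-≡0 xs (f≡0 ∘ there))

  sumℤ-map-single : ∀ {xs} → Unique xs → ∀ {x₀} → x₀ ∈ₗ xs →
                    (∀ {x} → x ∈ₗ xs → x ≢ x₀ → f x ≡ 0ℤ) → sumℤ (map f xs) ≡ f x₀
  sumℤ-map-single {x ∷ xs} (x∉xs ∷ _) (here refl) others≡0 = begin
    f x ℤ.+ sumℤ (map f xs)
      ≡⟨ cong (λ z → f x ℤ.+ z) (sumℤ-map-≡0 xs λ y∈xs →
           others≡0 (there y∈xs) (≢-sym (All.lookup x∉xs y∈xs))) ⟩
    f x ℤ.+ 0ℤ
      ≡⟨ ℤₚ.+-identityʳ (f x) ⟩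
    f x ∎
  sumℤ-map-single {x ∷ xs} (x∉xs ∷ xs!) {x₀} (there x₀∈xs) others≡0 = begin
    f x ℤ.+ sumℤ (map f xs)
      ≡⟨ cong₂ ℤ._+_ (others≡0 (here refl) (All.lookup x∉xs x₀∈xs))
                     (sumℤ-map-single xs! x₀∈xs (others≡0 ∘ there)) ⟩
    0ℤ ℤ.+ f x₀
      ≡⟨ ℤₚ.+-identityˡ (f x₀) ⟩
    f x₀ ∎

module _ {A : Set} {P Q : Pred A 0ℓ} (P? : Decidable P) (Q? : Decidable Q) where

  length-filter-cong : ∀ xs → (∀ {x} → x ∈ₗ xs → P x ⇔ Q x) →
                       length (filter P? xs) ≡ length (filter Q? xs)
  length-filter-cong [] _ = refl
  length-filter-cong (x ∷ xs) P⇔Q with P? x | Q? x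
  ... | yes _  | yes _  = cong suc (length-filter-cong xs (P⇔Q ∘ there))
  ... | yes Px | no ¬Qx = contradiction (to (P⇔Q (here refl)) Px) ¬Qx
  ... | no ¬Px | yes Qx = contradiction (from (P⇔Q (here refl)) Qx) ¬Px
  ... | no _   | no _   = length-filter-cong xs (P⇔Q ∘ there)

  length-filter-insert : ∀ {xs} → Unique xs → ∀ {x₀} → x₀ ∈ₗ xs → P x₀ → ¬ Q x₀ →
                         (∀ {x} → x ∈ₗ xs → x ≢ x₀ → P x ⇔ Q x) →
                         length (filter P? xs) ≡ suc (length (filter Q? xs))
  length-filter-insert {x ∷ xs} (x∉xs ∷ _) (here refl) Px ¬Qx P⇔Q with P? x | Q? x
  ... | no ¬Px | _      = contradiction Px ¬Px
  ... | yes _  | yes Qx = contradiction Qx ¬Qx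
  ... | yes _  | no _   = cong suc (length-filter-cong xs λ y∈xs →
                            P⇔Q (there y∈xs) (≢-sym (All.lookup x∉xs y∈xs)))
  length-filter-insert {x ∷ xs} (x∉xs ∷ xs!) (there x₀∈xs) Px₀ ¬Qx₀ P⇔Q with P? x | Q? x
  ... | yes _  | yes _  = cong suc (length-filter-insert xs! x₀∈xs Px₀ ¬Qx₀ (P⇔Q ∘ there))
  ... | no _   | no _   = length-filter-insert xs! x₀∈xs Px₀ ¬Qx₀ (P⇔Q ∘ there)
  ... | yes Px | no ¬Qx = contradiction (to (P⇔Q (here refl) (All.lookup x∉xs x₀∈xs)) Px) ¬Qx
  ... | no ¬Px | yes Qx = contradiction (from (P⇔Q (here refl) (All.lookup x∉xs x₀∈xs)) Qx) ¬Px

length≤1+length-filter-≢ : {A : Set} (_≟_ : DecidableEquality A) (a : A) {xs : List A} →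
                           Unique xs → length xs ℕ.≤ suc (length (filter (λ x → ¬? (x ≟ a)) xs))
length≤1+length-filter-≢ _≟_ a {[]} _ = z≤n
length≤1+length-filter-≢ _≟_ a {x ∷ xs} (x∉xs ∷ xs!) with x ≟ a
... | yes refl = s≤s (ℕₚ.≤-reflexive (sym (cong length
                   (Listₚ.filter-all (λ y → ¬? (y ≟ a)) (All.map ≢-sym x∉xs)))))
... | no _     = s≤s (length≤1+length-filter-≢ _≟_ a xs!)

x∉p∖x : ∀ (p : Subset n) x → x ∉ p ∖ x
x∉p∖x (_ ∷ p) zero    ()
x∉p∖x (_ ∷ p) (suc x) (there x∈p∖x) = x∉p∖x p x x∈p∖x

∈∖⇒∈ : y ∈ p ∖ x → y ∈ p
∈∖⇒∈ {p = p} {x} = Subsetₚ.p─q⊆p p ⁅ x ⁆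

∈∖⇒≢ : y ∈ p ∖ x → y ≢ x
∈∖⇒≢ {p = p} y∈p∖x refl = x∉p∖x p _ y∈p∖x

open Subsetₚ using () renaming (x∈p∧x≢y⇒x∈p-y to x∈p∧x≢y⇒x∈p∖y)

∖-injective : w ∈ p → p ∖ v ≡ p ∖ w → v ≡ w
∖-injective {w = w} {p} {v} w∈p p∖v≡p∖w with v Finₚ.≟ w
... | yes v≡w = v≡w
... | no v≢w  = contradiction (subst (w ∈_) p∖v≡p∖w (x∈p∧x≢y⇒x∈p∖y w∈p (≢-sym v≢w))) (x∉p∖x p w)

∈∪⁅⁆⁻ : y ∈ p ∪ ⁅ x ⁆ → y ∈ p ⊎ y ≡ x
∈∪⁅⁆⁻ {p = p} {x} y∈ with Subsetₚ.x∈p∪q⁻ p ⁅ x ⁆ y∈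
... | inj₁ y∈p  = inj₁ y∈p
... | inj₂ y∈⁅x⁆ = inj₂ (Subsetₚ.x∈⁅y⁆⇒x≡y x y∈⁅x⁆)

p⊆p∪⁅x⁆ : p ⊆ p ∪ ⁅ x ⁆
p⊆p∪⁅x⁆ {x = x} = Subsetₚ.p⊆p∪q ⁅ x ⁆

x∈p∪⁅x⁆ : x ∈ p ∪ ⁅ x ⁆
x∈p∪⁅x⁆ {x = x} = Subsetₚ.x∈p∪q⁺ (inj₂ (Subsetₚ.x∈⁅x⁆ x))

p∪⁅x⁆⊆q : p ⊆ q → x ∈ q → p ∪ ⁅ x ⁆ ⊆ q
p∪⁅x⁆⊆q p⊆q x∈q y∈ with ∈∪⁅⁆⁻ y∈
... | inj₁ y∈p  = p⊆q y∈p
... | inj₂ refl = x∈q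

p≡p∪⁅x⁆∖x : x ∉ p → p ≡ (p ∪ ⁅ x ⁆) ∖ x
p≡p∪⁅x⁆∖x x∉p = Subsetₚ.⊆-antisym
  (λ y∈p → x∈p∧x≢y⇒x∈p∖y (p⊆p∪⁅x⁆ y∈p) λ { refl → x∉p y∈p })
  (λ y∈ → [ (λ y∈p → y∈p) , (λ y≡x → contradiction y≡x (∈∖⇒≢ y∈)) ] (∈∪⁅⁆⁻ (∈∖⇒∈ y∈)))

suc∣p∖x∣≡∣p∣ : x ∈ p → suc ∣ p ∖ x ∣ ≡ ∣ p ∣
suc∣p∖x∣≡∣p∣ {x = zero}  {inside ∷ p}  here          = cong (suc ∘ ∣_∣) (Subsetₚ.p─⊥≡p p)
suc∣p∖x∣≡∣p∣ {x = suc x} {inside ∷ p}  (there x∈p) = cong suc (suc∣p∖x∣≡∣p∣ x∈p)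
suc∣p∖x∣≡∣p∣ {x = suc x} {outside ∷ p} (there x∈p) = suc∣p∖x∣≡∣p∣ x∈p

∣p∪⁅x⁆∣≡suc∣p∣ : x ∉ p → ∣ p ∪ ⁅ x ⁆ ∣ ≡ suc ∣ p ∣
∣p∪⁅x⁆∣≡suc∣p∣ {x = x} {p} x∉p = begin
  ∣ p ∪ ⁅ x ⁆ ∣          ≡⟨ suc∣p∖x∣≡∣p∣ (x∈p∪⁅x⁆ {p = p}) ⟨
  suc ∣ (p ∪ ⁅ x ⁆) ∖ x ∣ ≡⟨ cong (suc ∘ ∣_∣) (p≡p∪⁅x⁆∖x x∉p) ⟨
  suc ∣ p ∣              ∎

⊈⇒∃∉ : ¬ (q ⊆ p) → ∃[ x ] x ∈ q × x ∉ p
⊈⇒∃∉ {n} {q} {p} q⊈p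
  with Finₚ.¬∀⟶∃¬ n _ (λ x → (x ∈? q) →-dec (x ∈? p)) (λ q⊆p → q⊈p (q⊆p _))
... | x , ¬[x∈q→x∈p] with x ∈? q
...   | yes x∈q = x , x∈q , λ x∈p → ¬[x∈q→x∈p] (λ _ → x∈p)
...   | no x∉q  = contradiction (λ x∈q → contradiction x∈q x∉q) ¬[x∈q→x∈p]

⊆∧∣∣≥⇒≡ : p ⊆ q → ∣ q ∣ ℕ.≤ ∣ p ∣ → p ≡ q
⊆∧∣∣≥⇒≡ {p = p} {q} p⊆q ∣q∣≤∣p∣ with q Subsetₚ.⊆? p
... | yes q⊆p = Subsetₚ.⊆-antisym p⊆q q⊆p
... | no q⊈p  = contradiction ∣q∣≤∣p∣ (ℕₚ.<⇒≱ (Subsetₚ.p⊂q⇒∣p∣<∣q∣ (p⊆q , ⊈⇒∃∉ q⊈p)))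

coface≡p∪⁅x⁆ : ∣ q ∣ ≡ suc ∣ p ∣ → p ⊆ q → x ∈ q → x ∉ p → q ≡ p ∪ ⁅ x ⁆
coface≡p∪⁅x⁆ ∣q∣≡ p⊆q x∈q x∉p = sym (⊆∧∣∣≥⇒≡ (p∪⁅x⁆⊆q p⊆q x∈q)
  (ℕₚ.≤-reflexive (trans ∣q∣≡ (sym (∣p∪⁅x⁆∣≡suc∣p∣ x∉p)))))

module _ {A : Set} (R : A → Fin n → Set) where

  labelled⇒length≤∣∣ : ∀ {xs} → Unique xs → (S : Subset n) →
    (∀ {x} → x ∈ₗ xs → ∃[ v ] v ∈ S × R x v) →
    (∀ {x y v} → x ∈ₗ xs → y ∈ₗ xs → v ∈ S → R x v → R y v → x ≡ y) →
    length xs ℕ.≤ ∣ S ∣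
  labelled⇒length≤∣∣ {[]} _ _ _ _ = z≤n
  labelled⇒length≤∣∣ {x ∷ xs} (x∉xs ∷ xs!) S label label-injective with label (here refl)
  ... | v , v∈S , Rxv = ℕₚ.≤-trans
    (s≤s (labelled⇒length≤∣∣ xs! (S ∖ v) label′ λ x∈ y∈ w∈ →
      label-injective (there x∈) (there y∈) (∈∖⇒∈ w∈)))
    (Subsetₚ.x∈p⇒∣p-x∣<∣p∣ v∈S)
    where
    label′ : ∀ {y} → y ∈ₗ xs → ∃[ w ] w ∈ S ∖ v × R y w
    label′ y∈xs with label (there y∈xs)
    ... | w , w∈S , Ryw = w , x∈p∧x≢y⇒x∈p∖y w∈S w≢v , Ryw
      where
      w≢v : w ≢ v
      w≢v refl = All.lookup x∉xs y∈xs
        (label-injective (here refl) (there y∈xs) v∈S Rxv Ryw)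

∈allSubsets : ∀ (p : Subset n) → p ∈ₗ allSubsets n
∈allSubsets [] = here refl
∈allSubsets {suc n} (outside ∷ p) =
  Memₚ.∈-++⁺ˡ (Memₚ.∈-map⁺ (outside ∷_) (∈allSubsets p))
∈allSubsets {suc n} (inside ∷ p) =
  Memₚ.∈-++⁺ʳ (map (outside ∷_) (allSubsets n)) (Memₚ.∈-map⁺ (inside ∷_) (∈allSubsets p))

allSubsets-unique : ∀ n → Unique (allSubsets n)
allSubsets-unique ℕ.zero = [] ∷ []
allSubsets-unique (suc n) = Uniqueₚ.++⁺
  (Uniqueₚ.map⁺ ∷-injectiveʳ (allSubsets-unique n))
  (Uniqueₚ.map⁺ ∷-injectiveʳ (allSubsets-unique n))
  λ (out∈ , in∈) → outside≢inside (Memₚ.∈-map⁻ (outside ∷_) out∈) (Memₚ.∈-map⁻ (inside ∷_) in∈)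
  where
  outside≢inside : ∀ {s : Subset (suc n)} →
                   ∃[ p ] p ∈ₗ allSubsets n × s ≡ outside ∷ p →
                   ∃[ q ] q ∈ₗ allSubsets n × s ≡ inside ∷ q → ⊥
  outside≢inside (_ , _ , refl) (_ , _ , ())

clique-size? : (G : Graph n) (m : ℕ) → Decidable (λ s → Clique G s × ∣ s ∣ ≡ m)
clique-size? G m s = clique? G s ×-dec (∣ s ∣ ℕₚ.≟ m)

∈cliquesOfSize⁻ : ∀ (G : Graph n) m → s ∈ₗ cliquesOfSize G m → Clique G s × ∣ s ∣ ≡ m
∈cliquesOfSize⁻ {n} G m s∈ = proj₂ (Memₚ.∈-filter⁻ (clique-size? G m) {xs = allSubsets n} s∈)

∈cliquesOfSize⁺ : ∀ (G : Graph n) m → Clique G s → ∣ s ∣ ≡ m → s ∈ₗ cliquesOfSize G m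
∈cliquesOfSize⁺ {s = s} G m s-clique ∣s∣≡m =
  Memₚ.∈-filter⁺ (clique-size? G m) (∈allSubsets s) (s-clique , ∣s∣≡m)

cliquesOfSize-unique : ∀ (G : Graph n) m → Unique (cliquesOfSize G m)
cliquesOfSize-unique {n} G m = Uniqueₚ.filter⁺ (clique-size? G m) (allSubsets-unique n)

Clique-⊆ : ∀ (G : Graph n) → p ⊆ q → Clique G q → Clique G p
Clique-⊆ G p⊆q q-clique x y x∈p y∈p = q-clique x y (p⊆q x∈p) (p⊆q y∈p)

incTerm : Subset n → Subset n → Fin n → ℤ
incTerm σ τ v with v ∈? τ | σ ≟ˢ (τ ∖ v)
... | yes _ | yes _ = sgn (smaller τ v)
... | yes _ | no _  = 0ℤ
... | no _  | _     = 0ℤ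

-- The summand of inc is local to a where block of Defs and cannot be named; inc-as-sum
-- exposes it by unfolding inc, and it is then identified with incTerm by the same case split.
inc≡sum-incTerm : ∀ (σ τ : Subset n) → inc σ τ ≡ sumℤ (map (incTerm σ τ) (allFin n))
inc≡sum-incTerm {n} σ τ = trans (proj₂ (inc-as-sum σ τ))
  (cong sumℤ (Listₚ.map-cong summand≗incTerm (allFin n)))
  where
  inc-as-sum : ∀ σ τ → ∃[ t ] inc σ τ ≡ sumℤ (map t (allFin n))
  inc-as-sum σ τ = _ , refl
  summand≗incTerm : ∀ v → proj₁ (inc-as-sum σ τ) v ≡ incTerm σ τ v
  summand≗incTerm v with v ∈? τ | σ ≟ˢ (τ ∖ v)
  ... | yes _ | yes _ = refl
  ... | yes _ | no _  = refl
  ... | no _  | _     = refl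

inc≢0⇒facet : inc σ τ ≢ 0ℤ → ∃[ w ] w ∈ τ × σ ≡ τ ∖ w
inc≢0⇒facet {n} {σ} {τ} inc≢0
  with sumℤ-map-≢0 (incTerm σ τ) (allFin n) (inc≢0 ∘ trans (inc≡sum-incTerm σ τ))
... | w , _ , term≢0 with w ∈? τ | σ ≟ˢ (τ ∖ w)
...   | yes w∈τ | yes σ≡ = w , w∈τ , σ≡
...   | yes _   | no _   = contradiction refl term≢0
...   | no _    | _      = contradiction refl term≢0

inc-facet : w ∈ τ → σ ≡ τ ∖ w → inc σ τ ≡ sgn (smaller τ w)
inc-facet {n} {w} {τ} {σ} w∈τ σ≡τ∖w = begin
  inc σ τ                                  ≡⟨ inc≡sum-incTerm σ τ ⟩
  sumℤ (map (incTerm σ τ) (allFin n))      ≡⟨ sumℤ-map-single (incTerm σ τ) (Uniqueₚ.allFin⁺ n)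
                                                (Memₚ.∈-allFin w) others≡0 ⟩
  incTerm σ τ w                            ≡⟨ at-w ⟩
  sgn (smaller τ w)                        ∎
  where
  at-w : incTerm σ τ w ≡ sgn (smaller τ w)
  at-w with w ∈? τ | σ ≟ˢ (τ ∖ w)
  ... | yes _   | yes _  = refl
  ... | yes _   | no σ≢  = contradiction σ≡τ∖w σ≢
  ... | no w∉τ  | _      = contradiction w∈τ w∉τ
  others≡0 : ∀ {x} → x ∈ₗ allFin n → x ≢ w → incTerm σ τ x ≡ 0ℤ
  others≡0 {x} _ x≢w with x ∈? τ | σ ≟ˢ (τ ∖ x)
  ... | yes _ | yes σ≡τ∖x = contradiction (∖-injective w∈τ (trans (sym σ≡τ∖x) σ≡τ∖w)) x≢w
  ... | yes _ | no _      = refl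
  ... | no _  | _         = refl

smaller-cong : (∀ {y} → y < w → y ∈ p ⇔ y ∈ q) → smaller p w ≡ smaller q w
smaller-cong {n} {w} {p} {q} p⇔q = length-filter-cong
  (λ y → (y ∈? p) ×-dec (y Finₚ.<? w)) (λ y → (y ∈? q) ×-dec (y Finₚ.<? w)) (allFin n)
  λ {y} _ → mk⇔ (λ (y∈p , y<w) → to (p⇔q y<w) y∈p , y<w)
                (λ (y∈q , y<w) → from (p⇔q y<w) y∈q , y<w)

smaller-∖-< : x ∈ p → x < w → smaller p w ≡ suc (smaller (p ∖ x) w)
smaller-∖-< {n} {x} {p} {w} x∈p x<w = length-filter-insert
  (λ y → (y ∈? p) ×-dec (y Finₚ.<? w)) (λ y → (y ∈? p ∖ x) ×-dec (y Finₚ.<? w))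
  (Uniqueₚ.allFin⁺ n) (Memₚ.∈-allFin x) (x∈p , x<w) (λ (x∈p∖x , _) → x∉p∖x p x x∈p∖x)
  λ _ y≢x → mk⇔ (λ (y∈p , y<w) → x∈p∧x≢y⇒x∈p∖y y∈p y≢x , y<w)
                (λ (y∈p∖x , y<w) → ∈∖⇒∈ y∈p∖x , y<w)

smaller-∖-> : w < x → smaller (p ∖ x) w ≡ smaller p w
smaller-∖-> {w = w} {x} {p} w<x = smaller-cong {w = w} {p = p ∖ x} {q = p} λ y<w → mk⇔ ∈∖⇒∈
  λ y∈p → x∈p∧x≢y⇒x∈p∖y y∈p λ { refl → Finₚ.<-asym y<w w<x }

x*y+[-y]*x≡0 : ∀ x y → x * y ℤ.+ (- y) * x ≡ 0ℤ
x*y+[-y]*x≡0 x y = begin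
  x * y ℤ.+ (- y) * x    ≡⟨ cong (λ z → x * y ℤ.+ z) (ℤₚ.neg-distribˡ-* y x) ⟨
  x * y ℤ.+ - (y * x)    ≡⟨ cong (λ z → x * y ℤ.+ - z) (ℤₚ.*-comm y x) ⟩
  x * y ℤ.+ - (x * y)    ≡⟨ ℤₚ.+-inverseʳ (x * y) ⟩
  0ℤ                     ∎

x*y+y*[-x]≡0 : ∀ x y → x * y ℤ.+ y * (- x) ≡ 0ℤ
x*y+y*[-x]≡0 x y = begin
  x * y ℤ.+ y * (- x)    ≡⟨ cong (λ z → x * y ℤ.+ z) (ℤₚ.neg-distribʳ-* y x) ⟨
  x * y ℤ.+ - (y * x)    ≡⟨ cong (λ z → x * y ℤ.+ - z) (ℤₚ.*-comm y x) ⟩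
  x * y ℤ.+ - (x * y)    ≡⟨ ℤₚ.+-inverseʳ (x * y) ⟩
  0ℤ                     ∎

facet-signs-cancel : u ∈ τ → v ∈ τ → u ≢ v →
  sgn (smaller (τ ∖ v) u) * sgn (smaller (τ ∖ u) v) ℤ.+ sgn (smaller τ v) * sgn (smaller τ u) ≡ 0ℤ
facet-signs-cancel {u = u} {τ} {v} u∈τ v∈τ u≢v with Finₚ.<-cmp u v
... | tri≈ _ u≡v _ = contradiction u≡v u≢v
... | tri< u<v _ _ = trans
  (cong₂ (λ a b → sgn a * sgn (smaller (τ ∖ u) v) ℤ.+ sgn b * sgn (smaller τ u))
         (smaller-∖-> u<v) (smaller-∖-< u∈τ u<v))
  (x*y+[-y]*x≡0 (sgn (smaller τ u)) (sgn (smaller (τ ∖ u) v)))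
... | tri> _ _ v<u = trans
  (cong₂ (λ a b → sgn (smaller (τ ∖ v) u) * sgn a ℤ.+ sgn (smaller τ v) * sgn b)
         (smaller-∖-> v<u) (smaller-∖-< v∈τ v<u))
  (x*y+y*[-x]≡0 (sgn (smaller (τ ∖ v) u)) (sgn (smaller τ v)))

inc-square-cancel : u ∈ τ → v ∈ τ → u ≢ v →
  inc (τ ∖ v ∖ u) (τ ∖ v) * inc (τ ∖ v ∖ u) (τ ∖ u) ℤ.+ inc (τ ∖ v) τ * inc (τ ∖ u) τ ≡ 0ℤ
inc-square-cancel {u = u} {τ} {v} u∈τ v∈τ u≢v = trans
  (cong₂ ℤ._+_
    (cong₂ _*_ (inc-facet (x∈p∧x≢y⇒x∈p∖y u∈τ u≢v) refl)
               (inc-facet (x∈p∧x≢y⇒x∈p∖y v∈τ (≢-sym u≢v)) (Subsetₚ.p─x─y≡p─y─x τ v u)))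
    (cong₂ _*_ (inc-facet v∈τ refl) (inc-facet u∈τ refl)))
  (facet-signs-cancel u∈τ v∈τ u≢v)

record Swap (i j : Subset n) (u v : Fin n) : Set where
  field
    u∈i : u ∈ i
    v∉i : v ∉ i
    j≡  : j ≡ (i ∖ u) ∪ ⁅ v ⁆

  u≢v : u ≢ v
  u≢v refl = v∉i u∈i

  ∈j⁻ : x ∈ j → (x ∈ i × x ≢ u) ⊎ x ≡ v
  ∈j⁻ x∈j with ∈∪⁅⁆⁻ (subst (_ ∈_) j≡ x∈j)
  ... | inj₁ x∈i∖u = inj₁ (∈∖⇒∈ x∈i∖u , ∈∖⇒≢ x∈i∖u)
  ... | inj₂ x≡v   = inj₂ x≡v

  ∈j⁺ : x ∈ i → x ≢ u → x ∈ j
  ∈j⁺ x∈i x≢u = subst (_ ∈_) (sym j≡) (p⊆p∪⁅x⁆ (x∈p∧x≢y⇒x∈p∖y x∈i x≢u))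

  v∈j : v ∈ j
  v∈j = subst (_ ∈_) (sym j≡) (x∈p∪⁅x⁆ {p = i ∖ u})

  u∉j : u ∉ j
  u∉j u∈j with ∈j⁻ u∈j
  ... | inj₁ (_ , u≢u) = u≢u refl
  ... | inj₂ u≡v       = u≢v u≡v

  i≢j : i ≢ j
  i≢j i≡j = u∉j (subst (_ ∈_) i≡j u∈i)

  ∈j∧∉i⇒≡v : x ∈ j → x ∉ i → x ≡ v
  ∈j∧∉i⇒≡v x∈j x∉i with ∈j⁻ x∈j
  ... | inj₁ (x∈i , _) = contradiction x∈i x∉i
  ... | inj₂ x≡v       = x≡v

  i≡i∪⁅v⁆∖v : i ≡ (i ∪ ⁅ v ⁆) ∖ v
  i≡i∪⁅v⁆∖v = p≡p∪⁅x⁆∖x v∉i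

  j≡i∪⁅v⁆∖u : j ≡ (i ∪ ⁅ v ⁆) ∖ u
  j≡i∪⁅v⁆∖u = Subsetₚ.⊆-antisym
    (λ x∈j → case-j (∈j⁻ x∈j))
    (λ x∈ → case-i∪⁅v⁆ (∈∪⁅⁆⁻ (∈∖⇒∈ x∈)) (∈∖⇒≢ x∈))
    where
    case-j : (x ∈ i × x ≢ u) ⊎ x ≡ v → x ∈ (i ∪ ⁅ v ⁆) ∖ u
    case-j (inj₁ (x∈i , x≢u)) = x∈p∧x≢y⇒x∈p∖y (p⊆p∪⁅x⁆ x∈i) x≢u
    case-j (inj₂ refl)        = x∈p∧x≢y⇒x∈p∖y (x∈p∪⁅x⁆ {p = i}) (≢-sym u≢v)
    case-i∪⁅v⁆ : x ∈ i ⊎ x ≡ v → x ≢ u → x ∈ j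
    case-i∪⁅v⁆ (inj₁ x∈i) x≢u = ∈j⁺ x∈i x≢u
    case-i∪⁅v⁆ (inj₂ refl) _  = v∈j

  j∖v≡i∖u : j ∖ v ≡ i ∖ u
  j∖v≡i∖u = begin
    j ∖ v                   ≡⟨ cong (_∖ v) j≡i∪⁅v⁆∖u ⟩
    (i ∪ ⁅ v ⁆) ∖ u ∖ v     ≡⟨ Subsetₚ.p─x─y≡p─y─x (i ∪ ⁅ v ⁆) u v ⟩
    (i ∪ ⁅ v ⁆) ∖ v ∖ u     ≡⟨ cong (_∖ u) i≡i∪⁅v⁆∖v ⟨
    i ∖ u                   ∎

common-facet⇒Swap : i ≢ j → i ∖ u ≡ j ∖ w → u ∈ i → w ∈ j → Swap i j u w
common-facet⇒Swap {i = i} {j} {u} {w} i≢j i∖u≡j∖w u∈i w∈j = record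
  { u∈i = u∈i
  ; v∉i = w∉i
  ; j≡  = Subsetₚ.⊆-antisym j⊆ ⊆j
  }
  where
  u≢w : u ≢ w
  u≢w refl = i≢j (Subsetₚ.⊆-antisym (⊆-by-facet i∖u≡j∖w w∈j) (⊆-by-facet (sym i∖u≡j∖w) u∈i))
    where
    ⊆-by-facet : ∀ {p q} → p ∖ u ≡ q ∖ u → u ∈ q → p ⊆ q
    ⊆-by-facet {p} {q} p∖u≡q∖u u∈q {x} x∈p with x Finₚ.≟ u
    ... | yes refl = u∈q
    ... | no x≢u   = ∈∖⇒∈ (subst (_ ∈_) p∖u≡q∖u (x∈p∧x≢y⇒x∈p∖y x∈p x≢u))
  w∉i : w ∉ i
  w∉i w∈i = x∉p∖x j w (subst (_ ∈_) i∖u≡j∖w (x∈p∧x≢y⇒x∈p∖y w∈i (≢-sym u≢w)))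
  j⊆ : j ⊆ (i ∖ u) ∪ ⁅ w ⁆
  j⊆ {x} x∈j with x Finₚ.≟ w
  ... | yes refl = x∈p∪⁅x⁆ {p = i ∖ u}
  ... | no x≢w   = p⊆p∪⁅x⁆ (subst (_ ∈_) (sym i∖u≡j∖w) (x∈p∧x≢y⇒x∈p∖y x∈j x≢w))
  ⊆j : (i ∖ u) ∪ ⁅ w ⁆ ⊆ j
  ⊆j = p∪⁅x⁆⊆q (λ x∈i∖u → ∈∖⇒∈ (subst (_ ∈_) i∖u≡j∖w x∈i∖u)) w∈j

common-coface⇒Swap : i ≢ j → i ≡ τ ∖ v → j ≡ τ ∖ u → v ∈ τ → u ∈ τ → Swap i j u v
common-coface⇒Swap {i = i} {j} {τ} {v} {u} i≢j i≡τ∖v j≡τ∖u v∈τ u∈τ =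
  common-facet⇒Swap i≢j i∖u≡j∖v (subst (u ∈_) (sym i≡τ∖v) (x∈p∧x≢y⇒x∈p∖y u∈τ u≢v))
                             (subst (v ∈_) (sym j≡τ∖u) (x∈p∧x≢y⇒x∈p∖y v∈τ (≢-sym u≢v)))
  where
  u≢v : u ≢ v
  u≢v refl = i≢j (trans i≡τ∖v (sym j≡τ∖u))
  i∖u≡j∖v : i ∖ u ≡ j ∖ v
  i∖u≡j∖v = begin
    i ∖ u      ≡⟨ cong (_∖ u) i≡τ∖v ⟩
    τ ∖ v ∖ u  ≡⟨ Subsetₚ.p─x─y≡p─y─x τ v u ⟩
    τ ∖ u ∖ v  ≡⟨ cong (_∖ v) j≡τ∖u ⟨
    j ∖ v      ∎

Swap⇒facet≡ : Swap i j u v → σ ⊆ i → σ ≡ j ∖ w → σ ≡ i ∖ u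
Swap⇒facet≡ {v = v} {w = w} swap σ⊆i σ≡j∖w with w Finₚ.≟ v
... | yes refl = trans σ≡j∖w (Swap.j∖v≡i∖u swap)
... | no w≢v   = contradiction
  (σ⊆i (subst (_ ∈_) (sym σ≡j∖w) (x∈p∧x≢y⇒x∈p∖y (Swap.v∈j swap) (≢-sym w≢v)))) (Swap.v∉i swap)

Swap⇒coface≡ : Swap i j u v → i ≡ τ ∖ x → j ≡ τ ∖ y → τ ≡ i ∪ ⁅ v ⁆
Swap⇒coface≡ {i = i} {j} {v = v} {τ} {x} {y} swap i≡τ∖x j≡τ∖y =
  Subsetₚ.⊆-antisym τ⊆ (p∪⁅x⁆⊆q (λ z∈i → ∈∖⇒∈ (subst (_ ∈_) i≡τ∖x z∈i))
                                   (∈∖⇒∈ (subst (_ ∈_) j≡τ∖y v∈j)))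
  where
  open Swap swap
  τ⊆ : τ ⊆ i ∪ ⁅ v ⁆
  τ⊆ {z} z∈τ with z Finₚ.≟ x
  ... | no z≢x   = p⊆p∪⁅x⁆ (subst (_ ∈_) (sym i≡τ∖x) (x∈p∧x≢y⇒x∈p∖y z∈τ z≢x))
  ... | yes refl = subst (_∈ i ∪ ⁅ v ⁆) (sym (∈j∧∉i⇒≡v z∈j z∉i)) (x∈p∪⁅x⁆ {p = i})
    where
    z∉i : z ∉ i
    z∉i z∈i = x∉p∖x τ z (subst (_ ∈_) i≡τ∖x z∈i)
    z∈j : z ∈ j
    z∈j = subst (_ ∈_) (sym j≡τ∖y) (x∈p∧x≢y⇒x∈p∖y z∈τ λ { refl → i≢j (trans i≡τ∖x (sym j≡τ∖y)) })

inc*inc≢0⇒facets : ∀ {σ τ σ′ τ′ : Subset n} → inc σ τ * inc σ′ τ′ ≢ 0ℤ →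
                   (∃[ w ] w ∈ τ × σ ≡ τ ∖ w) × (∃[ w ] w ∈ τ′ × σ′ ≡ τ′ ∖ w)
inc*inc≢0⇒facets {σ = σ} {τ} {σ′} {τ′} product≢0 =
  inc≢0⇒facet (λ inc≡0 → product≢0 (trans (cong (_* inc σ′ τ′) inc≡0) (ℤₚ.*-zeroˡ (inc σ′ τ′)))) ,
  inc≢0⇒facet (λ inc≡0 → product≢0 (trans (cong (inc σ τ *_) inc≡0) (ℤₚ.*-zeroʳ (inc σ τ))))

laplacian≢0⇒Swap : ∀ (G : Graph n) k → i ≢ j → laplacian G k i j ≢ 0ℤ → ∃₂ (Swap i j)
laplacian≢0⇒Swap {i = i} {j} G k i≢j Δ≢0
  with sumℤ (map (λ σ → inc σ i * inc σ j) (cliquesOfSize G k)) ℤ.≟ 0ℤ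
... | no down≢0 with sumℤ-map-≢0 (λ σ → inc σ i * inc σ j) (cliquesOfSize G k) down≢0
...   | _ , _ , term≢0 with inc*inc≢0⇒facets term≢0
...     | (u , u∈i , σ≡i∖u) , (w , w∈j , σ≡j∖w) =
          u , w , common-facet⇒Swap i≢j (trans (sym σ≡i∖u) σ≡j∖w) u∈i w∈j
laplacian≢0⇒Swap {i = i} {j} G k i≢j Δ≢0
    | yes down≡0 with sumℤ-map-≢0 (λ τ → inc i τ * inc j τ) (cliquesOfSize G (suc (suc k)))
                                  (λ up≡0 → Δ≢0 (cong₂ ℤ._+_ down≡0 up≡0))
...   | _ , _ , term≢0 with inc*inc≢0⇒facets term≢0
...     | (v , v∈τ , i≡τ∖v) , (u , u∈τ , j≡τ∖u) =
          u , v , common-coface⇒Swap i≢j i≡τ∖v j≡τ∖u v∈τ u∈τ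

-- Both sums reduce to a single term, the down term through i ∖ u and the up term through
-- i ∪ ⁅ v ⁆ (this is where the clique hypothesis enters); they are the two paths of
-- inc-square-cancel.
Swap∧Clique⇒laplacian≡0 : ∀ (G : Graph n) k → IsFace G k i → Swap i j u v → Clique G (i ∪ ⁅ v ⁆) →
                          laplacian G k i j ≡ 0ℤ
Swap∧Clique⇒laplacian≡0 {n} {i = i} {j} {u} {v} G k (i-clique , ∣i∣≡1+k) swap τ₀-clique = begin
  laplacian G k i j
    ≡⟨ cong₂ ℤ._+_ (sumℤ-map-single _ (cliquesOfSize-unique G k) i∖u∈ down≡0)
                   (sumℤ-map-single _ (cliquesOfSize-unique G (suc (suc k))) τ₀∈ up≡0) ⟩
  inc (i ∖ u) i * inc (i ∖ u) j ℤ.+ inc i τ₀ * inc j τ₀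
    ≡⟨ cong₂ (λ i′ j′ → inc (i′ ∖ u) i′ * inc (i′ ∖ u) j′ ℤ.+ inc i′ τ₀ * inc j′ τ₀)
             i≡i∪⁅v⁆∖v j≡i∪⁅v⁆∖u ⟩
  inc (τ₀ ∖ v ∖ u) (τ₀ ∖ v) * inc (τ₀ ∖ v ∖ u) (τ₀ ∖ u) ℤ.+ inc (τ₀ ∖ v) τ₀ * inc (τ₀ ∖ u) τ₀
    ≡⟨ inc-square-cancel (p⊆p∪⁅x⁆ u∈i) (x∈p∪⁅x⁆ {p = i}) u≢v ⟩
  0ℤ ∎
  where
  open Swap swap
  τ₀ : Subset n
  τ₀ = i ∪ ⁅ v ⁆
  i∖u∈ : i ∖ u ∈ₗ cliquesOfSize G k
  i∖u∈ = ∈cliquesOfSize⁺ G k (Clique-⊆ G ∈∖⇒∈ i-clique)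
           (ℕₚ.suc-injective (trans (suc∣p∖x∣≡∣p∣ u∈i) ∣i∣≡1+k))
  τ₀∈ : τ₀ ∈ₗ cliquesOfSize G (suc (suc k))
  τ₀∈ = ∈cliquesOfSize⁺ G (suc (suc k)) τ₀-clique (trans (∣p∪⁅x⁆∣≡suc∣p∣ v∉i) (cong suc ∣i∣≡1+k))
  down≡0 : ∀ {σ} → σ ∈ₗ cliquesOfSize G k → σ ≢ i ∖ u → inc σ i * inc σ j ≡ 0ℤ
  down≡0 _ σ≢i∖u = decidable-stable (_ ℤ.≟ 0ℤ) λ term≢0 →
    let (_ , _ , σ≡i∖w) , (_ , _ , σ≡j∖w) = inc*inc≢0⇒facets term≢0
    in σ≢i∖u (Swap⇒facet≡ swap (λ x∈σ → ∈∖⇒∈ (subst (_ ∈_) σ≡i∖w x∈σ)) σ≡j∖w)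
  up≡0 : ∀ {τ′} → τ′ ∈ₗ cliquesOfSize G (suc (suc k)) → τ′ ≢ τ₀ → inc i τ′ * inc j τ′ ≡ 0ℤ
  up≡0 _ τ′≢τ₀ = decidable-stable (_ ℤ.≟ 0ℤ) λ term≢0 →
    let (_ , _ , i≡τ′∖x) , (_ , _ , j≡τ′∖y) = inc*inc≢0⇒facets term≢0
    in τ′≢τ₀ (Swap⇒coface≡ swap i≡τ′∖x j≡τ′∖y)

laplacian≢0⇒Swap∧¬Clique : ∀ (G : Graph n) k → IsFace G k i → i ≢ j → laplacian G k i j ≢ 0ℤ →
                           ∃₂ λ u v → Swap i j u v × ¬ Clique G (i ∪ ⁅ v ⁆)
laplacian≢0⇒Swap∧¬Clique G k i-face i≢j Δ≢0 with laplacian≢0⇒Swap G k i≢j Δ≢0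
... | u , v , swap = u , v , swap , λ clique → Δ≢0 (Swap∧Clique⇒laplacian≡0 G k i-face swap clique)

Swaps⇒Clique : ∀ (G : Graph n) → Clique G i → Clique G s → Clique G t →
               Swap i s u v → Swap i t w v → u ≢ w → Clique G (i ∪ ⁅ v ⁆)
Swaps⇒Clique {i = i} {u = u} {v} G i-clique s-clique t-clique swap₁ swap₂ u≢w a b a∈ b∈ =
  by-cases (∈∪⁅⁆⁻ a∈) (∈∪⁅⁆⁻ b∈)
  where
  adj-v : ∀ {x} → x ∈ i → x ≢ v → Adj G v x ≡ true
  adj-v {x} x∈i x≢v with x Finₚ.≟ u
  ... | no x≢u   = s-clique v x (Swap.v∈j swap₁) (Swap.∈j⁺ swap₁ x∈i x≢u) (≢-sym x≢v)
  ... | yes refl = t-clique v x (Swap.v∈j swap₂) (Swap.∈j⁺ swap₂ x∈i u≢w) (≢-sym x≢v)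
  by-cases : a ∈ i ⊎ a ≡ v → b ∈ i ⊎ b ≡ v → a ≢ b → Adj G a b ≡ true
  by-cases (inj₁ a∈i) (inj₁ b∈i) a≢b = i-clique a b a∈i b∈i a≢b
  by-cases (inj₂ refl) (inj₂ refl) a≢b = contradiction refl a≢b
  by-cases (inj₂ refl) (inj₁ b∈i) a≢b = adj-v b∈i (≢-sym a≢b)
  by-cases (inj₁ a∈i) (inj₂ refl) a≢b = trans (Adj-sym G a b) (adj-v a∈i a≢b)

Swap-target-unique : ∀ (G : Graph n) → Clique G i → Clique G s → Clique G t →
                     Swap i s u v → Swap i t w v → ¬ Clique G (i ∪ ⁅ v ⁆) → s ≡ t
Swap-target-unique {u = u} {w = w} G i-clique s-clique t-clique swap₁ swap₂ ¬clique
  with u Finₚ.≟ w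
... | yes refl = trans (Swap.j≡ swap₁) (sym (Swap.j≡ swap₂))
... | no u≢w   = contradiction (Swaps⇒Clique G i-clique s-clique t-clique swap₁ swap₂ u≢w) ¬clique

Swap∧¬Clique-at : ∀ (G : Graph n) → Swap i j u v → ¬ Clique G (i ∪ ⁅ v ⁆) → x ∈ j → x ∉ i →
                  Swap i j u x × ¬ Clique G (i ∪ ⁅ x ⁆)
Swap∧¬Clique-at G swap ¬clique x∈j x∉i with Swap.∈j∧∉i⇒≡v swap x∈j x∉i
... | refl = swap , ¬clique

module RowSupport {n} (G : Graph n) (k : ℕ) {i : Subset n} (i-face : IsFace G k i) where

  support offSupport cofaces counted : List (Subset n)
  support    = filter (λ j → ¬? (laplacian G k i j ℤ.≟ 0ℤ)) (faces G k)
  offSupport = filter (λ j → ¬? (j ≟ˢ i)) support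
  cofaces    = filter (λ τ → Finₚ.all? λ u → (u ∈? i) →-dec (u ∈? τ))
                      (cliquesOfSize G (suc (suc k)))
  counted    = offSupport ++ cofaces

  1+k≤n : suc k ℕ.≤ n
  1+k≤n = subst (ℕ._≤ n) (proj₂ i-face) (Subsetₚ.∣p∣≤n i)

  ∈offSupport⁻ : j ∈ₗ offSupport → (Clique G j × ∣ j ∣ ≡ suc k) × laplacian G k i j ≢ 0ℤ × j ≢ i
  ∈offSupport⁻ j∈ =
    let j∈support , j≢i = Memₚ.∈-filter⁻ (λ j → ¬? (j ≟ˢ i)) {xs = support} j∈
        j∈faces , Δ≢0 = Memₚ.∈-filter⁻ (λ j → ¬? (laplacian G k i j ℤ.≟ 0ℤ)) j∈support
    in ∈cliquesOfSize⁻ G (suc k) j∈faces , Δ≢0 , j≢i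

  ∈cofaces⁻ : τ ∈ₗ cofaces → (Clique G τ × ∣ τ ∣ ≡ suc (suc k)) × i ⊆ τ
  ∈cofaces⁻ τ∈ =
    let τ∈cliques , i⊆τ = Memₚ.∈-filter⁻ (λ τ → Finₚ.all? λ u → (u ∈? i) →-dec (u ∈? τ))
                                          {xs = cliquesOfSize G (suc (suc k))} τ∈
    in ∈cliquesOfSize⁻ G (suc (suc k)) τ∈cliques , i⊆τ _

  offSupport-Swap : j ∈ₗ offSupport → ∃₂ λ u v → Swap i j u v × ¬ Clique G (i ∪ ⁅ v ⁆)
  offSupport-Swap j∈ =
    let _ , Δ≢0 , j≢i = ∈offSupport⁻ j∈ in laplacian≢0⇒Swap∧¬Clique G k i-face (≢-sym j≢i) Δ≢0

  offSupport-Swap-at : j ∈ₗ offSupport → v ∈ j → v ∉ i →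
                       ∃[ u ] Swap i j u v × ¬ Clique G (i ∪ ⁅ v ⁆)
  offSupport-Swap-at j∈ v∈j v∉i =
    let u , _ , swap , ¬clique = offSupport-Swap j∈ in u , Swap∧¬Clique-at G swap ¬clique v∈j v∉i

  new-vertex : s ∈ₗ counted → ∃[ v ] v ∈ ∁ i × v ∈ s
  new-vertex s∈ = [ in-offSupport , in-cofaces ] (Memₚ.∈-++⁻ offSupport s∈)
    where
    in-offSupport : s ∈ₗ offSupport → ∃[ v ] v ∈ ∁ i × v ∈ s
    in-offSupport s∈off =
      let _ , v , swap , _ = offSupport-Swap s∈off
      in v , Subsetₚ.x∉p⇒x∈∁p (Swap.v∉i swap) , Swap.v∈j swap
    in-cofaces : τ ∈ₗ cofaces → ∃[ v ] v ∈ ∁ i × v ∈ τ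
    in-cofaces {τ} τ∈co =
      let (_ , ∣τ∣≡2+k) , _ = ∈cofaces⁻ τ∈co
          v , v∈τ , v∉i = ⊈⇒∃∉ {q = τ} {p = i} λ τ⊆i →
            ℕₚ.<⇒≱ (ℕₚ.≤-reflexive (trans (cong suc (proj₂ i-face)) (sym ∣τ∣≡2+k)))
                   (Subsetₚ.p⊆q⇒∣p∣≤∣q∣ τ⊆i)
      in v , Subsetₚ.x∉p⇒x∈∁p v∉i , v∈τ

  offSupport-injective : s ∈ₗ offSupport → t ∈ₗ offSupport → v ∈ s → v ∈ t → v ∉ i → s ≡ t
  offSupport-injective s∈ t∈ v∈s v∈t v∉i =
    let _ , swap₁ , ¬clique = offSupport-Swap-at s∈ v∈s v∉i
        _ , swap₂ , _       = offSupport-Swap-at t∈ v∈t v∉i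
    in Swap-target-unique G (proj₁ i-face) (proj₁ (proj₁ (∈offSupport⁻ s∈)))
                          (proj₁ (proj₁ (∈offSupport⁻ t∈))) swap₁ swap₂ ¬clique

  coface≡i∪⁅v⁆ : τ ∈ₗ cofaces → v ∈ τ → v ∉ i → τ ≡ i ∪ ⁅ v ⁆
  coface≡i∪⁅v⁆ τ∈ v∈τ v∉i =
    let (_ , ∣τ∣≡2+k) , i⊆τ = ∈cofaces⁻ τ∈
    in coface≡p∪⁅x⁆ (trans ∣τ∣≡2+k (cong suc (sym (proj₂ i-face)))) i⊆τ v∈τ v∉i

  offSupport-cofaces-disjoint : s ∈ₗ offSupport → τ ∈ₗ cofaces → v ∈ s → v ∈ τ → v ∉ i → ⊥
  offSupport-cofaces-disjoint s∈ τ∈ v∈s v∈τ v∉i =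
    let _ , _ , ¬clique = offSupport-Swap-at s∈ v∈s v∉i
        (τ-clique , _) , i⊆τ = ∈cofaces⁻ τ∈
    in contradiction (Clique-⊆ G (p∪⁅x⁆⊆q i⊆τ v∈τ) τ-clique) ¬clique

  new-vertex-injective : s ∈ₗ counted → t ∈ₗ counted → v ∈ ∁ i → v ∈ s → v ∈ t → s ≡ t
  new-vertex-injective {s} {t} {v} s∈ t∈ v∈∁i v∈s v∈t =
    by-cases (Memₚ.∈-++⁻ offSupport s∈) (Memₚ.∈-++⁻ offSupport t∈)
    where
    v∉i : v ∉ i
    v∉i = Subsetₚ.x∈∁p⇒x∉p v∈∁i
    by-cases : s ∈ₗ offSupport ⊎ s ∈ₗ cofaces → t ∈ₗ offSupport ⊎ t ∈ₗ cofaces → s ≡ t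
    by-cases (inj₁ s∈) (inj₁ t∈) = offSupport-injective s∈ t∈ v∈s v∈t v∉i
    by-cases (inj₁ s∈) (inj₂ t∈) = ⊥-elim (offSupport-cofaces-disjoint s∈ t∈ v∈s v∈t v∉i)
    by-cases (inj₂ s∈) (inj₁ t∈) = ⊥-elim (offSupport-cofaces-disjoint t∈ s∈ v∈t v∈s v∉i)
    by-cases (inj₂ s∈) (inj₂ t∈) = trans (coface≡i∪⁅v⁆ s∈ v∈s v∉i) (sym (coface≡i∪⁅v⁆ t∈ v∈t v∉i))

  counted-unique : Unique counted
  counted-unique = Uniqueₚ.++⁺
    (Uniqueₚ.filter⁺ _ (Uniqueₚ.filter⁺ _ (cliquesOfSize-unique G (suc k))))
    (Uniqueₚ.filter⁺ _ (cliquesOfSize-unique G (suc (suc k))))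
    λ (s∈off , s∈co) → ℕₚ.1+n≢n (trans (sym (proj₂ (proj₁ (∈cofaces⁻ s∈co))))
                                       (proj₂ (proj₁ (∈offSupport⁻ s∈off))))

  length-counted : length offSupport + length cofaces ℕ.≤ n ∸ suc k
  length-counted = subst₂ ℕ._≤_ (Listₚ.length-++ offSupport)
    (trans (Subsetₚ.∣∁p∣≡n∸∣p∣ i) (cong (n ∸_) (proj₂ i-face)))
    (labelled⇒length≤∣∣ (λ s v → v ∈ s) counted-unique (∁ i) new-vertex
      λ s∈ t∈ v∈∁i → new-vertex-injective s∈ t∈ v∈∁i)

  rowSupport+upDegree≤n∸k : rowSupport G k i + upDegree G k i ℕ.≤ n ∸ k
  rowSupport+upDegree≤n∸k = ℕₚ.≤-trans
    (ℕₚ.+-monoˡ-≤ (length cofaces)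
      (length≤1+length-filter-≢ _≟ˢ_ i (Uniqueₚ.filter⁺ _ (cliquesOfSize-unique G (suc k)))))
    (ℕₚ.≤-trans (s≤s length-counted) (ℕₚ.≤-reflexive (sym (ℕₚ.+-∸-assoc 1 1+k≤n))))

+m≤+n-+k-+d : ∀ {m d n} k → k ℕ.≤ n → m + d ℕ.≤ n ∸ k → + m ≤ + n - + k - + d
+m≤+n-+k-+d {m} {d} {n} k k≤n m+d≤n∸k = subst (+ m ≤_) +[n∸k∸d]≡ (ℤ.+≤+ (ℕₚ.m+n≤o⇒m≤o∸n m m+d≤n∸k))
  where
  +[m∸o]≡+m-+o : ∀ {m o} → o ℕ.≤ m → + (m ∸ o) ≡ + m - + o
  +[m∸o]≡+m-+o {m} {o} o≤m = sym (trans (ℤₚ.m-n≡m⊖n m o) (ℤₚ.≤-⊖ o≤m))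
  +[n∸k∸d]≡ : + (n ∸ k ∸ d) ≡ + n - + k - + d
  +[n∸k∸d]≡ = trans (+[m∸o]≡+m-+o (ℕₚ.m+n≤o⇒n≤o m m+d≤n∸k))
                    (cong (_- + d) (+[m∸o]≡+m-+o k≤n))

lemma4p2 : ∀ {n} (G : Graph n) (k : ℕ) (i : Subset n) → IsFace G k i →
    + rowSupport G k i ≤ + n - + k - + upDegree G k i
lemma4p2 G k i i-face =
  +m≤+n-+k-+d k (ℕₚ.<⇒≤ 1+k≤n) rowSupport+upDegree≤n∸k
  where open RowSupport G k i-face
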